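{- Let $f:\mathbb{N}\to\mathbb{N}$ be a multiplicative function such that $f(p^{k-1})\le f(p^k)$ for every prime $p$ and integer $k\ge1$. Then every $f$-practical number is weakly $f$-practical.
   Context: $\mathbb{N}$ denotes the positive integers. $S_f(n)=\sum_{d\mid n} f(d)$. A positive integer $n$ is $f$-practical if every positive integer $m\le S_f(n)$ can be written as $m=\sum_{d\in\mathcal{D}} f(d)$ for some set $\mathcal{D}$ of divisors of $n$. Write $n=p_1^{e_1}\cdots p_k^{e_k}$ with distinct primes indexed so that $f(p_1)\le\cdots\le f(p_k)$, and put $m_i=\prod_{j=1}^i p_j^{e_j}$ for $0\le i<k$ (so $m_0=1$); $n$ is weakly $f$-practical if $f(p_{i+1})\le S_f(m_i)+1$ for every $0\le i<k$. -}

module Defs where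

open import Data.Nat using (ℕ; zero; suc; _+_; _*_; _^_; _≤_)
open import Data.Nat.Divisibility using (_∣_; _∣?_)
open import Data.Nat.Primality using (Prime)
open import Data.Nat.Coprimality using (Coprime)
open import Data.List using (List; []; _∷_; map; filter; upTo)
open import Data.Nat.ListAction using (sum; product)
open import Relation.Binary.PropositionalEquality using (_≡_)
open import Data.List.Relation.Unary.All using (All)
open import Data.List.Relation.Unary.Linked using (Linked)
open import Data.List.Relation.Unary.Unique.Propositional using (Unique)
open import Data.List.Relation.Binary.Sublist.Propositional using (_⊆_)
open import Data.Product using (_×_; _,_; proj₁; proj₂; ∃)
open import Data.Unit using (⊤)

-- f is a function on the positive integers with values in the positive integers;
-- we model it as ℕ → ℕ and only constrain / use its values at positive arguments.
PositiveValued : (ℕ → ℕ) → Set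
PositiveValued f = ∀ n → 1 ≤ n → 1 ≤ f n

Multiplicative : (ℕ → ℕ) → Set
Multiplicative f = (f 1 ≡ 1) × (∀ m n → 1 ≤ m → 1 ≤ n → Coprime m n → f (m * n) ≡ f m * f n)

divisors : ℕ → List ℕ
divisors n = filter (_∣? n) (map suc (upTo n))

S : (ℕ → ℕ) → ℕ → ℕ
S f n = sum (map f (divisors n))

-- n is f-practical: every 1 ≤ m ≤ S_f(n) is Σ_{d ∈ D} f(d) for a set D of divisors of n
-- (a set of divisors = a sublist of the duplicate-free list of divisors)
Practical : (ℕ → ℕ) → ℕ → Set
Practical f n = ∀ m → 1 ≤ m → m ≤ S f n →
  ∃ λ (D : List ℕ) → (D ⊆ divisors n) × (sum (map f D) ≡ m)

IsFactorization : ℕ → List (ℕ × ℕ) → Set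
IsFactorization n fs =
  All (λ pe → Prime (proj₁ pe) × 1 ≤ proj₂ pe) fs ×
  Unique (map proj₁ fs) ×
  (product (map (λ pe → proj₁ pe ^ proj₂ pe) fs) ≡ n)

SortedBy : (ℕ → ℕ) → List (ℕ × ℕ) → Set
SortedBy f fs = Linked (λ a b → f (proj₁ a) ≤ f (proj₁ b)) fs

-- WeakCond f m fs : with m = m_i the product of the prime powers already processed,
-- f(p_{i+1}) ≤ S_f(m_i) + 1 for each remaining factor, updating m_{i+1} = m_i p_{i+1}^{e_{i+1}}.
WeakCond : (ℕ → ℕ) → ℕ → List (ℕ × ℕ) → Set
WeakCond f m [] = ⊤
WeakCond f m ((p , e) ∷ fs) = (f p ≤ S f m + 1) × WeakCond f (m * p ^ e) fs

WeaklyPractical : (ℕ → ℕ) → ℕ → Set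
WeaklyPractical f n = ∀ fs → IsFactorization n fs → SortedBy f fs → WeakCond f 1 fs

{-# OPTIONS --safe #-}
-- Fix i, put m = m_i and p = p_{i+1}. A divisor d of n not dividing m is divisible by some
-- p_j with j > i, and then f(d) ≥ f(p_j^a) ≥ f(p_j) ≥ f(p) by multiplicativity, monotonicity
-- on prime powers and the ordering of the primes. Were f(p) > S_f(m) + 1, a set D of divisors
-- of n with Σ_D f = S_f(m) + 1 ≤ S_f(n) could only contain divisors of m, whence
-- Σ_D f ≤ S_f(m), a contradiction.
module Submission where

open import Defs
open import Data.Nat using (ℕ; _≤_; _∸_; _^_)
open import Data.Nat.Primality using (Prime)

open import Level using (Level)
open import Function using (_∘_)
open import Data.Nat using (zero; suc; _+_; _*_; _<_; _≤′_; ≤′-refl; ≤′-step; NonZero; NonTrivial; >-nonZero; z≤n; s≤s)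
open import Data.Nat.Properties
open import Data.Nat.Induction using (<-wellFounded)
open import Data.Nat.Divisibility
open import Data.Nat.Coprimality using (Coprime; coprime-divisor)
import Data.Nat.Coprimality as Coprime
open import Data.Nat.Primality using (prime⇒irreducible; prime⇒nonZero; prime⇒nonTrivial; ¬prime[1])
open import Data.Nat.ListAction using (sum; product)
open import Algebra.Properties.CommutativeSemigroup *-commutativeSemigroup using (x∙yz≈y∙xz)
open import Data.List using (List; []; _∷_; map; filter; upTo; _++_; [_])
open import Data.List.Properties using (upTo-∷ʳ; map-++; filter-++; filter-reject; filter-all; ++-identityʳ)
open import Data.List.Membership.Propositional using (_∈_)
open import Data.List.Membership.Propositional.Properties using (∈-map⁺; ∈-map⁻; ∈-filter⁺; ∈-filter⁻; ∈-upTo⁺)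
open import Data.List.Relation.Unary.Any using (Any; here; there)
open import Data.List.Relation.Unary.All as All using (All; _∷_; lookupAny)
open import Data.List.Relation.Unary.Linked as Linked using ()
open import Data.List.Relation.Unary.Linked.Properties using (Linked⇒All)
open import Data.List.Relation.Binary.Sublist.Propositional using (_⊆_; []; _∷_; _∷ʳ_; from∈)
open import Data.List.Relation.Binary.Sublist.Propositional.Properties using (filter-⊆; filter⁺; Any-resp-⊆)
open import Data.Product using (_×_; _,_; proj₁; proj₂; ∃₂)
open import Data.Sum as Sum using (_⊎_; inj₁; inj₂)
open import Data.Unit using (tt)
open import Induction.WellFounded using (Acc; acc)
open import Relation.Nullary using (¬_; yes; no; contradiction; decidable-stable)
open import Relation.Unary using (Pred; Decidable)
open import Relation.Binary.PropositionalEquality using (_≡_; refl; sym; trans; cong; subst; module ≡-Reasoning)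

private
  variable
    ℓ : Level
    A : Set ℓ
    P Q : Pred A ℓ
    x : A
    xs ys : List A
    a b c d k m n p : ℕ

prime∤⇒coprime : Prime p → ¬ p ∣ d → Coprime p d
prime∤⇒coprime p-prime p∤d (i∣p , i∣d) with prime⇒irreducible p-prime i∣p
... | inj₁ i≡1  = i≡1
... | inj₂ refl = contradiction i∣d p∤d

coprime-*ʳ : Coprime a b → Coprime a c → Coprime a (b * c)
coprime-*ʳ a⊥b a⊥c (i∣a , i∣b*c) =
  a⊥c (i∣a , coprime-divisor (λ (j∣i , j∣b) → a⊥b (∣-trans j∣i i∣a , j∣b)) i∣b*c)

coprime-^ʳ : Coprime a b → ∀ k → Coprime a (b ^ k)
coprime-^ʳ a⊥b zero    (_ , i∣1) = ∣1⇒≡1 i∣1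
coprime-^ʳ a⊥b (suc k) = coprime-*ʳ a⊥b (coprime-^ʳ a⊥b k)

m*n∣m⇒n≡1 : .{{NonZero m}} → m * n ∣ m → n ≡ 1
m*n∣m⇒n≡1 {m} {n} m*n∣m =
  *-cancelˡ-≡ n 1 m (trans (∣-antisym m*n∣m (m∣m*n n)) (sym (*-identityʳ m)))

m∣m^k : 1 ≤ k → m ∣ m ^ k
m∣m^k {suc k} {m} _ = m∣m*n (m ^ k)

split-prime-power : Prime p → ∀ d .{{_ : NonZero d}} → ∃₂ λ k d′ → ¬ p ∣ d′ × d ≡ p ^ k * d′
split-prime-power {p} p-prime d = go d (<-wellFounded d)
  where
  instance
    p-nonTrivial : NonTrivial p
    p-nonTrivial = prime⇒nonTrivial p-prime

  go : ∀ d .{{_ : NonZero d}} → Acc _<_ d → ∃₂ λ k d′ → ¬ p ∣ d′ × d ≡ p ^ k * d′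
  go d (acc rec) with p ∣? d
  ... | no p∤d  = 0 , d , p∤d , sym (*-identityˡ d)
  ... | yes p∣d with go (quotient p∣d) {{quotient≢0 p∣d}} (rec (quotient-< p∣d))
  ...   | k , d′ , p∤d′ , q≡ = suc k , d′ , p∤d′ , (begin
          d                   ≡⟨ m∣n⇒n≡m*quotient p∣d ⟩
          p * quotient p∣d    ≡⟨ cong (p *_) q≡ ⟩
          p * (p ^ k * d′)    ≡⟨ *-assoc p (p ^ k) d′ ⟨
          p ^ suc k * d′      ∎)
    where open ≡-Reasoning

PrimePowerMonotone : (ℕ → ℕ) → Set
PrimePowerMonotone f = ∀ p k → Prime p → 1 ≤ k → f (p ^ (k ∸ 1)) ≤ f (p ^ k)

module _ {f : ℕ → ℕ} (pos : PositiveValued f) (mult : Multiplicative f)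
         (mono : PrimePowerMonotone f) where

  f[p]≤f[p^1+k] : Prime p → ∀ k → f p ≤ f (p ^ suc k)
  f[p]≤f[p^1+k] {p} _       zero    = ≤-reflexive (cong f (sym (*-identityʳ p)))
  f[p]≤f[p^1+k] {p} p-prime (suc k) =
    ≤-trans (f[p]≤f[p^1+k] p-prime k) (mono p (2 + k) p-prime (s≤s z≤n))

  f[p]≤f[d] : Prime p → p ∣ d → 1 ≤ d → f p ≤ f d
  f[p]≤f[d] {p} {d} p-prime p∣d d≥1 with split-prime-power p-prime d {{>-nonZero d≥1}}
  ... | zero  , d′ , p∤d′ , d≡ = contradiction (subst (p ∣_) (trans d≡ (*-identityˡ d′)) p∣d) p∤d′
  ... | suc k , d′ , p∤d′ , d≡ = begin
    f p                     ≤⟨ f[p]≤f[p^1+k] p-prime k ⟩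
    f (p ^ suc k)           ≡⟨ *-identityʳ _ ⟨
    f (p ^ suc k) * 1       ≤⟨ *-monoʳ-≤ (f (p ^ suc k)) (pos d′ d′≥1) ⟩
    f (p ^ suc k) * f d′    ≡⟨ proj₂ mult (p ^ suc k) d′ p^1+k≥1 d′≥1 p^1+k⊥d′ ⟨
    f (p ^ suc k * d′)      ≡⟨ cong f d≡ ⟨
    f d                     ∎
    where
    open ≤-Reasoning
    instance
      p-nonZero : NonZero p
      p-nonZero = prime⇒nonZero p-prime
    d′≥1 : 1 ≤ d′
    d′≥1 = n≢0⇒n>0 λ { refl → p∤d′ (p ∣0) }
    p^1+k≥1 : 1 ≤ p ^ suc k
    p^1+k≥1 = m^n>0 p (suc k)
    p^1+k⊥d′ : Coprime (p ^ suc k) d′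
    p^1+k⊥d′ = Coprime.sym (coprime-^ʳ (Coprime.sym (prime∤⇒coprime p-prime p∤d′)) (suc k))

primePowerProduct : List (ℕ × ℕ) → ℕ
primePowerProduct fs = product (map (λ pe → proj₁ pe ^ proj₂ pe) fs)

∣m*∏⇒∣m⊎prime∣ : ∀ m fs → All (Prime ∘ proj₁) fs → d ∣ m * primePowerProduct fs →
                 d ∣ m ⊎ Any (λ pe → proj₁ pe ∣ d) fs
∣m*∏⇒∣m⊎prime∣ m [] _ d∣m*1 = inj₁ (subst (_ ∣_) (*-identityʳ m) d∣m*1)
∣m*∏⇒∣m⊎prime∣ {d} m ((p , e) ∷ fs) (p-prime ∷ primes) d∣m*∏ with p ∣? d
... | yes p∣d = inj₂ (here p∣d)
... | no  p∤d = Sum.map₂ there (∣m*∏⇒∣m⊎prime∣ m fs primes d∣m*∏fs)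
  where
  d⊥p^e : Coprime d (p ^ e)
  d⊥p^e = coprime-^ʳ (Coprime.sym (prime∤⇒coprime p-prime p∤d)) e
  d∣m*∏fs : d ∣ m * primePowerProduct fs
  d∣m*∏fs = coprime-divisor d⊥p^e (subst (d ∣_) (x∙yz≈y∙xz m (p ^ e) _) d∣m*∏)

module _ (f : A → ℕ) where

  sum-map-mono-⊆ : xs ⊆ ys → sum (map f xs) ≤ sum (map f ys)
  sum-map-mono-⊆ []           = ≤-refl
  sum-map-mono-⊆ (y ∷ʳ xs⊆)   = ≤-trans (sum-map-mono-⊆ xs⊆) (m≤n+m _ (f y))
  sum-map-mono-⊆ (refl ∷ xs⊆) = +-monoʳ-≤ _ (sum-map-mono-⊆ xs⊆)

  ∈⇒≤sum-map : x ∈ xs → f x ≤ sum (map f xs)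
  ∈⇒≤sum-map {x} x∈xs = ≤-trans (≤-reflexive (sym (+-identityʳ (f x)))) (sum-map-mono-⊆ (from∈ x∈xs))

  sum-map-filter+≤sum-map : (P? : Decidable P) → x ∈ xs → ¬ P x →
                            sum (map f (filter P? xs)) + f x ≤ sum (map f xs)
  sum-map-filter+≤sum-map {x = x} {xs = y ∷ xs} P? x∈ ¬Px with P? y | x∈
  ... | yes Py | here refl = contradiction Py ¬Px
  ... | no  _  | here refl =
    ≤-trans (≤-reflexive (+-comm _ (f y))) (+-monoʳ-≤ (f y) (sum-map-mono-⊆ (filter-⊆ P? xs)))
  ... | yes _  | there x∈xs = begin
    f y + sum (map f (filter P? xs)) + f x   ≡⟨ +-assoc (f y) _ (f x) ⟩
    f y + (sum (map f (filter P? xs)) + f x) ≤⟨ +-monoʳ-≤ (f y) (sum-map-filter+≤sum-map P? x∈xs ¬Px) ⟩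
    f y + sum (map f xs)                     ∎
    where open ≤-Reasoning
  ... | no  _  | there x∈xs =
    ≤-trans (sum-map-filter+≤sum-map P? x∈xs ¬Px) (m≤n+m _ (f y))

filter-absorb : (P? : Decidable P) (Q? : Decidable Q) → (∀ {x} → P x → Q x) →
                ∀ xs → filter P? (filter Q? xs) ≡ filter P? xs
filter-absorb P? Q? P⇒Q []       = refl
filter-absorb P? Q? P⇒Q (x ∷ xs) with Q? x
... | yes _ with P? x
...   | yes _ = cong (x ∷_) (filter-absorb P? Q? P⇒Q xs)
...   | no  _ = filter-absorb P? Q? P⇒Q xs
filter-absorb P? Q? P⇒Q (x ∷ xs) | no ¬Qx with P? x
...   | yes Px = contradiction (P⇒Q Px) ¬Qx
...   | no  _  = filter-absorb P? Q? P⇒Q xs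

filter-∣-upTo : .{{NonZero m}} → m ≤′ k → filter (_∣? m) (map suc (upTo k)) ≡ divisors m
filter-∣-upTo ≤′-refl = refl
filter-∣-upTo {m} (≤′-step {k} m≤′k) = begin
  filter (_∣? m) (map suc (upTo (suc k)))
    ≡⟨ cong (filter (_∣? m) ∘ map suc) (upTo-∷ʳ k) ⟨
  filter (_∣? m) (map suc (upTo k ++ [ k ]))
    ≡⟨ cong (filter (_∣? m)) (map-++ suc (upTo k) [ k ]) ⟩
  filter (_∣? m) (map suc (upTo k) ++ [ suc k ])
    ≡⟨ filter-++ (_∣? m) (map suc (upTo k)) [ suc k ] ⟩
  filter (_∣? m) (map suc (upTo k)) ++ filter (_∣? m) [ suc k ]
    ≡⟨ cong (filter (_∣? m) (map suc (upTo k)) ++_) (filter-reject (_∣? m) {xs = []} 1+k∤m) ⟩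
  filter (_∣? m) (map suc (upTo k)) ++ []
    ≡⟨ ++-identityʳ _ ⟩
  filter (_∣? m) (map suc (upTo k))
    ≡⟨ filter-∣-upTo m≤′k ⟩
  divisors m
    ∎
  where
  open ≡-Reasoning
  1+k∤m : ¬ suc k ∣ m
  1+k∤m 1+k∣m = <⇒≱ (s≤s (≤′⇒≤ m≤′k)) (∣⇒≤ 1+k∣m)

filter-∣-divisors : 1 ≤ n → m ∣ n → filter (_∣? m) (divisors n) ≡ divisors m
filter-∣-divisors {n} {zero}  n≥1 0∣n = contradiction (subst (1 ≤_) (0∣⇒≡0 0∣n) n≥1) λ ()
filter-∣-divisors {n} {suc m} n≥1 m∣n = trans
  (filter-absorb (_∣? suc m) (_∣? n) (λ d∣m → ∣-trans d∣m m∣n) (map suc (upTo n)))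
  (filter-∣-upTo (≤⇒≤′ (∣⇒≤ {{>-nonZero n≥1}} m∣n)))

∈-divisors⁻ : d ∈ divisors n → 1 ≤ d × d ∣ n
∈-divisors⁻ {n = n} d∈ with ∈-filter⁻ (_∣? n) {xs = map suc (upTo n)} d∈
... | d∈sucs , d∣n with ∈-map⁻ suc {xs = upTo n} d∈sucs
...   | _ , _ , refl = s≤s z≤n , d∣n

n∈divisors : 1 ≤ n → n ∈ divisors n
n∈divisors {suc n} _ = ∈-filter⁺ (_∣? suc n) (∈-map⁺ suc (∈-upTo⁺ ≤-refl)) ∣-refl

module _ (f : ℕ → ℕ) where

  S-proper-divisor : 1 ≤ n → m ∣ n → ¬ n ∣ m → S f m + f n ≤ S f n
  S-proper-divisor {n} {m} n≥1 m∣n n∤m =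
    subst (λ s → s + f n ≤ S f n) (cong (sum ∘ map f) (filter-∣-divisors n≥1 m∣n))
      (sum-map-filter+≤sum-map f (_∣? m) (n∈divisors n≥1) n∤m)

  sum-map≤S : ∀ {D} → 1 ≤ n → m ∣ n → D ⊆ divisors n → All (_∣ m) D → sum (map f D) ≤ S f m
  sum-map≤S {n} {m} {D} n≥1 m∣n D⊆ D∣m =
    subst (λ Ds → sum (map f D) ≤ sum (map f Ds)) (filter-∣-divisors n≥1 m∣n) (sum-map-mono-⊆ f D⊆m)
    where
    D⊆m : D ⊆ filter (_∣? m) (divisors n)
    D⊆m = subst (_⊆ filter (_∣? m) (divisors n)) (filter-all (_∣? m) D∣m)
                (filter⁺ (_∣? m) (_∣? m) (λ { refl d∣m → d∣m }) D⊆)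

practical-gap : ∀ {f F} → PositiveValued f → Practical f n → 1 ≤ n → m ∣ n → ¬ n ∣ m →
                (∀ {d} → 1 ≤ d → d ∣ n → ¬ d ∣ m → F ≤ f d) → F ≤ S f m + 1
practical-gap {n} {m} {f} {F} pos prac n≥1 m∣n n∤m large = ≮⇒≥ S+1≮F
  where
  S+1≮F : ¬ S f m + 1 < F
  S+1≮F S+1<F with prac (S f m + 1) (m≤n+m 1 (S f m))
                    (≤-trans (+-monoʳ-≤ (S f m) (pos n n≥1)) (S-proper-divisor f n≥1 m∣n n∤m))
  ... | D , D⊆ , ΣD≡S+1 = <-irrefl refl (begin-strict
      S f m           <⟨ m<m+n (S f m) (s≤s z≤n) ⟩
      S f m + 1       ≡⟨ ΣD≡S+1 ⟨
      sum (map f D)   ≤⟨ sum-map≤S f n≥1 m∣n D⊆ (All.tabulate D-divides-m) ⟩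
      S f m           ∎)
    where
    open ≤-Reasoning
    D-divides-m : d ∈ D → d ∣ m
    D-divides-m {d} d∈D = decidable-stable (d ∣? m) λ d∤m →
      let d≥1 , d∣n = ∈-divisors⁻ (Any-resp-⊆ D⊆ d∈D)
      in <⇒≱ S+1<F (≤-trans (large d≥1 d∣n d∤m)
                    (subst (f d ≤_) ΣD≡S+1 (∈⇒≤sum-map f d∈D)))

PrimePowerFactor : ℕ × ℕ → Set
PrimePowerFactor (p , e) = Prime p × 1 ≤ e

module _ {f : ℕ → ℕ} (pos : PositiveValued f) (mult : Multiplicative f)
         (mono : PrimePowerMonotone f) (n≥1 : 1 ≤ n) (prac : Practical f n) where

  practical⇒weakCond : ∀ m fs → All PrimePowerFactor fs → SortedBy f fs →
                       m * primePowerProduct fs ≡ n → WeakCond f m fs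
  practical⇒weakCond m []             _ _ _ = tt
  practical⇒weakCond m ((p , e) ∷ fs) factors@((p-prime , e≥1) ∷ factors′) sorted m*∏≡n =
    practical-gap pos prac n≥1 m∣n n∤m large ,
    practical⇒weakCond (m * p ^ e) fs factors′ (Linked.tail sorted) (trans (*-assoc m (p ^ e) _) m*∏≡n)
    where
    X : ℕ
    X = p ^ e * primePowerProduct fs

    instance
      m-nonZero : NonZero m
      m-nonZero = m*n≢0⇒m≢0 m {{>-nonZero (subst (1 ≤_) (sym m*∏≡n) n≥1)}}

    m∣n : m ∣ n
    m∣n = divides X (trans (sym m*∏≡n) (*-comm m X))

    n∤m : ¬ n ∣ m
    n∤m n∣m = ¬prime[1] (subst Prime (∣1⇒≡1 p∣1) p-prime)
      where
      p∣1 : p ∣ 1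
      p∣1 = subst (p ∣_) (m*n∣m⇒n≡1 (subst (_∣ m) (sym m*∏≡n) n∣m))
                  (∣m⇒∣m*n _ (m∣m^k e≥1))

    primes-above-p : All (λ qe → Prime (proj₁ qe) × f p ≤ f (proj₁ qe)) ((p , e) ∷ fs)
    primes-above-p = All.zip (All.map proj₁ factors ,
      Linked⇒All {R = λ pe qe → f (proj₁ pe) ≤ f (proj₁ qe)} ≤-trans {v = p , e} ≤-refl sorted)

    large : 1 ≤ d → d ∣ n → ¬ d ∣ m → f p ≤ f d
    large d≥1 d∣n d∤m
      with ∣m*∏⇒∣m⊎prime∣ m ((p , e) ∷ fs) (All.map proj₁ factors) (subst (_ ∣_) (sym m*∏≡n) d∣n)
    ... | inj₁ d∣m      = contradiction d∣m d∤m
    ... | inj₂ some-q∣d with lookupAny primes-above-p some-q∣d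
    ...   | (q-prime , f[p]≤f[q]) , q∣d = ≤-trans f[p]≤f[q] (f[p]≤f[d] pos mult mono q-prime q∣d d≥1)

theorem2p2 : (f : ℕ → ℕ) → PositiveValued f → Multiplicative f →
    (∀ p k → Prime p → 1 ≤ k → f (p ^ (k ∸ 1)) ≤ f (p ^ k)) →
    ∀ n → 1 ≤ n → Practical f n → WeaklyPractical f n
theorem2p2 f pos mult mono n n≥1 prac fs (factors , _ , ∏≡n) sorted =
  practical⇒weakCond pos mult mono n≥1 prac 1 fs factors sorted (trans (*-identityˡ _) ∏≡n)
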